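{- Let $k\ge 0$ and let $G^T$ be the graph obtained from $CC_k$ by replacing each vertex $v_i$ by a set $I(v_i)$ of $m_i$ pairwise adjacent vertices and each vertex $v'_i$ by a set $I(v'_i)$ of $m'_i$ pairwise adjacent vertices (two vertices in different sets are adjacent iff the corresponding vertices of $CC_k$ are adjacent), where $m_0,\dots,m_k\ge 1$, $m'_0,\dots,m'_{k-1}\ge 1$ and $m'_k\ge 0$. Let $\vec m=(m_0,\dots,m_k)$, $\vec m'=(m'_0,\dots,m'_k)$, and write $\sum\vec m=\sum_{j=0}^k m_j$, $\sum\vec m'=\sum_{j=0}^k m'_j$. For $-1\le i\le k$ and integers $0\le x\le\sum_{j=0}^i m_j$, $0\le x'\le\sum_{j=0}^i m'_j$, define $F_i(x,x')$ by $F_{ -1}(x,x')=0$ and, for $i\ge 0$, \[ F_i(x,x')=m'_i x'+m_i(x+x')+\max_{\substack{L_i\le s_i\le U_i\\ L'_i\le s'_i\le U'_i}}\Big\{F_{i-1}(x-s_i,x'-s'_i)+s'_i\Big(\sum_{j=0}^{i-1}m'_j-m_i-2x'\Big)+s_i\Big(\sum_{j=0}^{i-1}(m_j+m'_j)-2(x+x')\Big)+(s_i+s'_i)^2\Big\}, \] where $L_i=\max\big(0,x-\sum_{j=0}^{i-1}m_j\big)$, $U_i=\min(m_i,x)$, $L'_i=\max\big(0,x'-\sum_{j=0}^{i-1}m'_j\big)$, $U'_i=\min(m'_i,x')$. Then the maximum cut size of $G^T$ equals \[ \max\{F_k(x,x') : 0\le x\le \textstyle\sum\vec m,\ 0\le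 x'\le\sum\vec m'\}. \]
   Context: For an integer $k\ge 0$, $CC_k$ is the graph with vertex set $\{v_0,\dots,v_k\}\cup\{v'_0,\dots,v'_k\}$, where $\{v_0,\dots,v_k\}$ and $\{v'_0,\dots,v'_k\}$ are cliques and $v_i$ is adjacent to $v'_j$ if and only if $j<i$; there are no other edges. (Every co-bipartite chain graph, i.e. a graph whose vertex set partitions into two cliques $K,K'$ such that the neighborhoods of the vertices of $K$ are linearly ordered by inclusion, arises in this way after contracting classes of twins.) A cut of a graph is a subset $S$ of its vertices; its size is the number of edges with exactly one endpoint in $S$; the maximum cut size is the largest size of a cut. -}

module Defs where

open import Data.Nat as ℕ using (ℕ; zero; suc; _∸_; _⊓_)
open import Data.Integer as ℤ using (ℤ; +_; _⊔_)
open import Data.Fin using (Fin; toℕ; _≟_)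
open import Data.Bool using (Bool; true; false; not; _∧_; if_then_else_)
open import Data.List using (List; []; _∷_; map; concatMap; upTo; allFin; foldr; _++_)
open import Data.Nat.ListAction using (sum)
open import Data.Product using (Σ; _,_; _×_; ∃)
open import Data.Sum using (_⊎_; inj₁; inj₂)
open import Relation.Nullary.Decidable using (⌊_⌋)
open import Relation.Binary.PropositionalEquality using (_≡_)

-- Finite simple graphs given by an enumerating list of vertices
-- (each vertex listed exactly once) and a Boolean adjacency relation.

record FinGraph : Set₁ where
  field
    V     : Set
    verts : List V
    adj   : V → V → Bool
open FinGraph public

-- A cut is a subset S of the vertices (characteristic function).
-- Its size = number of edges with exactly one endpoint in S
--          = number of ordered pairs (u , v) with u ∈ S, v ∉ S, u ~ v.
cutSize : (G : FinGraph) → (V G → Bool) → ℕ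
cutSize G S =
  sum (concatMap (λ u → map (λ v → if S u ∧ not (S v) ∧ adj G u v then 1 else 0)
                            (verts G))
                 (verts G))

IsMaxCutSize : FinGraph → ℤ → Set
IsMaxCutSize G c =
  (∃ λ (S : V G → Bool) → + cutSize G S ≡ c) × (∀ (S : V G → Bool) → + cutSize G S ℤ.≤ c)

-- The blow-up G^T of CC_k.  m i = m_i, m' i = m'_i (only i ≤ k matter).
-- Vertex (inj₁ (i , a)) : a-th vertex of I(v_i);
-- vertex (inj₂ (i , a)) : a-th vertex of I(v'_i).

GTV : (k : ℕ) → (ℕ → ℕ) → (ℕ → ℕ) → Set
GTV k m m' = Σ (Fin (suc k)) (λ i → Fin (m (toℕ i)))
           ⊎ Σ (Fin (suc k)) (λ i → Fin (m' (toℕ i)))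

sameVertex : ∀ {n} (f : Fin n → ℕ) → Σ (Fin n) (λ i → Fin (f i)) → Σ (Fin n) (λ i → Fin (f i)) → Bool
sameVertex f (i , a) (j , b) = ⌊ toℕ i ℕ.≟ toℕ j ⌋ ∧ ⌊ toℕ a ℕ.≟ toℕ b ⌋

GT : (k : ℕ) → (m m' : ℕ → ℕ) → FinGraph
GT k m m' = record
  { V     = GTV k m m'
  ; verts = map inj₁ (concatMap (λ i → map (i ,_) (allFin (m (toℕ i)))) (allFin (suc k)))
         ++ map inj₂ (concatMap (λ i → map (i ,_) (allFin (m' (toℕ i)))) (allFin (suc k)))
  ; adj   = adjGT
  }
  where
  adjGT : GTV k m m' → GTV k m m' → Bool
  -- the two sides are cliques (and each I(·) is a clique)
  adjGT (inj₁ u) (inj₁ v) = not (sameVertex (λ i → m (toℕ i)) u v)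
  adjGT (inj₂ u) (inj₂ v) = not (sameVertex (λ i → m' (toℕ i)) u v)
  adjGT (inj₁ (i , _)) (inj₂ (j , _)) = ⌊ toℕ j ℕ.<? toℕ i ⌋
  adjGT (inj₂ (j , _)) (inj₁ (i , _)) = ⌊ toℕ j ℕ.<? toℕ i ⌋

psum : (ℕ → ℕ) → ℕ → ℕ
psum f zero    = 0
psum f (suc i) = psum f i ℕ.+ f i

-- range a b = [a, a+1, ..., b]  (empty if b < a)
range : ℕ → ℕ → List ℕ
range a b = map (a ℕ.+_) (upTo (suc b ∸ a))

-- maximum of a list (only ever applied to nonempty lists below)
maxL : List ℤ → ℤ
maxL []       = + 0
maxL (x ∷ xs) = foldr _⊔_ x xs

-- The recursion.  Fr m m' 0 x x' = F_{-1}(x,x') = 0 and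
-- Fr m m' (suc i) x x' = F_i(x,x').

Fr : (m m' : ℕ → ℕ) → ℕ → ℕ → ℕ → ℤ
Fr m m' zero    x x' = + 0
Fr m m' (suc i) x x' =
  + (m' i ℕ.* x') ℤ.+ + (m i ℕ.* (x ℕ.+ x')) ℤ.+
  maxL (concatMap (λ s → map (λ s' →
           Fr m m' i (x ∸ s) (x' ∸ s')
           ℤ.+ (+ s') ℤ.* (+ psum m' i ℤ.- + m i ℤ.- + (2 ℕ.* x'))
           ℤ.+ (+ s) ℤ.* (+ (psum m i ℕ.+ psum m' i) ℤ.- + (2 ℕ.* (x ℕ.+ x')))
           ℤ.+ (+ (s ℕ.+ s')) ℤ.* (+ (s ℕ.+ s')))
         (range (x' ∸ psum m' i) (m' i ⊓ x')))
       (range (x ∸ psum m i) (m i ⊓ x)))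

F : (m m' : ℕ → ℕ) → (i : ℕ) → ℕ → ℕ → ℤ
F m m' i = Fr m m' (suc i)

maxFk : (k : ℕ) → (m m' : ℕ → ℕ) → ℤ
maxFk k m m' =
  maxL (concatMap (λ x → map (λ x' → F m m' k x x')
                             (range 0 (psum m' (suc k))))
                  (range 0 (psum m (suc k))))

module Submission where

-- For a cut S let x_i = |S ∩ I(v_i)| and y_i = |S ∩ I(v'_i)|; the pair of sequences
-- (x, y) is the profile of S.  The proof has three independent parts.
--
-- 1. The recursion.  The value of a profile is the recursion F evaluated along the
--    fixed choices s_i = x_i, s'_i = y_i.  By induction on i, F_i(X, Y) is the largest
--    value of a profile that is bounded by (m, m') on the levels ≤ i and has totals X, Y
--    (value≤Fr, Fr-realised); maximising over X, Y yields maxFk.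
-- 2. Counting.  Splitting the double sum defining cutSize into the four blocks
--    side × side writes the size of S as a polynomial cutPoly in the level counts of S
--    and of its complement (cutSize≡cutPoly).
-- 3. Algebra.  Because x_i + z_i = m_i and y_i + z'_i = m'_i, cutPoly obeys the one-level
--    recurrence of the value (cutPoly≡value), by a ring identity over ℤ.
--
-- Hence every cut has size at most maxFk, and a profile of value maxFk is the profile
-- of the cut formed by the first x_i vertices of each I(v_i) and the first y_i of each
-- I(v'_i).

open import Defs
open import Data.Nat as ℕ
  using (ℕ; zero; suc; _+_; _*_; _∸_; _⊓_; _≤_; _<_; z≤n; s≤s; s≤s⁻¹; s<s⁻¹; _<ᵇ_; _<?_;
         _≤′_; ≤′-refl; ≤′-step)
open import Data.Nat.Properties
open import Data.Nat.ListAction using (sum)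
open import Data.Nat.ListAction.Properties using (sum-++)
open import Data.Integer as ℤ using (ℤ; +_; _⊔_)
import Data.Integer.Properties as ℤP
open import Data.Integer.Tactic.RingSolver using (solve-∀)
open import Algebra.Properties.CommutativeSemigroup +-commutativeSemigroup
  using () renaming (interchange to +-interchange)
open import Algebra.Bundles using (CommutativeMonoid)
open import Data.Bool.Properties using (∧-commutativeMonoid)
open import Algebra.Properties.CommutativeSemigroup
  (CommutativeMonoid.commutativeSemigroup ∧-commutativeMonoid)
  using () renaming (x∙yz≈y∙xz to ∧-left-comm)
open import Data.Fin using (Fin; toℕ; fromℕ<) renaming (zero to fzero; suc to fsuc)
open import Data.Fin.Properties using (toℕ-injective; toℕ<n; toℕ-fromℕ<; fromℕ<-toℕ)
open import Data.Bool using (Bool; true; false; not; _∧_; if_then_else_)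
open import Data.List
  using (List; []; _∷_; map; concatMap; allFin; tabulate; cartesianProductWith; _++_)
open import Data.List.Properties
  using (map-++; map-∘; map-cong; map-tabulate; map-concatMap; foldr-preservesᵒ)
open import Data.List.Membership.Propositional using (_∈_)
open import Data.List.Membership.Propositional.Properties
  using (∈-map⁺; ∈-map⁻; ∈-upTo⁺; ∈-upTo⁻; ∈-cartesianProductWith⁺; ∈-cartesianProductWith⁻;
         foldr-selective)
open import Data.List.Relation.Unary.Any as Any using (Any; here; there)
open import Data.Product using (Σ; _,_; _×_; ∃; ∃₂; proj₁; proj₂)
open import Data.Sum using (_⊎_; inj₁; inj₂)
open import Function using (_∘_; id)
open import Relation.Nullary using (¬_; yes; no; contradiction)
open import Relation.Nullary.Decidable using (Dec; ⌊_⌋)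
open import Relation.Binary.PropositionalEquality

-- Properties of all levels below n.  Profiles matter only on finitely many levels, so
-- bounds and equalities between sequences are stated level-wise below a given n.
Bounded : ℕ → (ℕ → ℕ) → (ℕ → ℕ) → Set
Bounded n x b = ∀ i → i < n → x i ≤ b i

AgreeBelow : ℕ → (ℕ → ℕ) → (ℕ → ℕ) → Set
AgreeBelow n f g = ∀ i → i < n → f i ≡ g i

below : ∀ {P : ℕ → Set} {n} → (∀ i → i < suc n → P i) → ∀ i → i < n → P i
below h i i<n = h i (m<n⇒m<1+n i<n)

at-top : ∀ {P : ℕ → Set} {n} → (∀ i → i < suc n → P i) → P n
at-top {n = n} h = h n (n<1+n n)

psum-cong : ∀ {f g} n → AgreeBelow n f g → psum f n ≡ psum g n
psum-cong zero    _   = refl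
psum-cong (suc n) f≗g = cong₂ _+_ (psum-cong n (below f≗g)) (at-top f≗g)

psum-mono : ∀ {f g} n → Bounded n f g → psum f n ≤ psum g n
psum-mono zero    _   = z≤n
psum-mono (suc n) f≤g = +-mono-≤ (psum-mono n (below f≤g)) (at-top f≤g)

psum-+ : ∀ f g n → psum f n + psum g n ≡ psum (λ i → f i + g i) n
psum-+ f g zero    = refl
psum-+ f g (suc n) =
  trans (+-interchange (psum f n) (f n) (psum g n) (g n)) (cong (_+ (f n + g n)) (psum-+ f g n))

psum-shift : ∀ h n → psum h (suc n) ≡ h 0 + psum (h ∘ suc) n
psum-shift h zero    = +-comm 0 (h 0)
psum-shift h (suc n) = trans (cong (_+ h (suc n)) (psum-shift h n)) (+-assoc (h 0) _ _)

psum-ones : ∀ n → psum (λ _ → 1) n ≡ n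
psum-ones zero    = refl
psum-ones (suc n) = trans (cong (_+ 1) (psum-ones n)) (+-comm n 1)

χ : Bool → ℕ
χ b = if b then 1 else 0

χ-∧ : ∀ a b → χ (a ∧ b) ≡ χ a * χ b
χ-∧ false b = refl
χ-∧ true  b = sym (*-identityˡ (χ b))

χ-not : ∀ b → χ b + χ (not b) ≡ 1
χ-not false = refl
χ-not true  = refl

⌊⌋-yes : ∀ {A : Set} (d : Dec A) → A → ⌊ d ⌋ ≡ true
⌊⌋-yes (yes _) _ = refl
⌊⌋-yes (no ¬a) a = contradiction a ¬a

⌊⌋-no : ∀ {A : Set} (d : Dec A) → ¬ A → ⌊ d ⌋ ≡ false
⌊⌋-no (yes a) ¬a = contradiction a ¬a
⌊⌋-no (no _)  _  = refl

psum-below : ∀ f {i n} → i ≤ n → psum (λ j → f j * χ ⌊ j <? i ⌋) n ≡ psum f i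
psum-below f {i} i≤n = truncate (≤⇒≤′ i≤n)
  where
  truncate : ∀ {n} → i ≤′ n → psum (λ j → f j * χ ⌊ j <? i ⌋) n ≡ psum f i
  truncate ≤′-refl =
    psum-cong i (λ j j<i → trans (cong (λ b → f j * χ b) (⌊⌋-yes (j <? i) j<i)) (*-identityʳ (f j)))
  truncate (≤′-step {n} i≤′n) =
    trans (cong₂ _+_ (truncate i≤′n) (cong (λ b → f n * χ b) (⌊⌋-no (n <? i) (≤⇒≯ (≤′⇒≤ i≤′n)))))
          (trans (cong (_+_ (psum f i)) (*-zeroʳ (f n))) (+-identityʳ (psum f i)))

set : (ℕ → ℕ) → ℕ → ℕ → ℕ → ℕ
set f n s i with i ℕ.≟ n
... | yes _ = s
... | no  _ = f i

set-at : ∀ f n s → set f n s n ≡ s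
set-at f n s with n ℕ.≟ n
... | yes _   = refl
... | no  n≢n = contradiction refl n≢n

set-below : ∀ f n s → AgreeBelow n (set f n s) f
set-below f n s i i<n with i ℕ.≟ n
... | yes refl = contradiction i<n (<-irrefl refl)
... | no  _    = refl

set-bounded : ∀ {f b n s} → Bounded n f b → s ≤ b n → Bounded (suc n) (set f n s) b
set-bounded {n = n} f≤b s≤ i i<1+n with i ℕ.≟ n
... | yes refl = s≤
... | no  i≢n  = f≤b i (≤∧≢⇒< (s≤s⁻¹ i<1+n) i≢n)

grid : {A B C : Set} → (A → B → C) → List A → List B → List C
grid f as bs = concatMap (λ a → map (f a) bs) as

grid≡cartesianProductWith : ∀ {A B C : Set} (f : A → B → C) as bs →
                            grid f as bs ≡ cartesianProductWith f as bs
grid≡cartesianProductWith f []       bs = refl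
grid≡cartesianProductWith f (a ∷ as) bs =
  cong (map (f a) bs ++_) (grid≡cartesianProductWith f as bs)

∈-grid⁺ : ∀ {A B C : Set} (f : A → B → C) {as bs a b} → a ∈ as → b ∈ bs → f a b ∈ grid f as bs
∈-grid⁺ f {as} {bs} a∈ b∈ =
  subst (f _ _ ∈_) (sym (grid≡cartesianProductWith f as bs)) (∈-cartesianProductWith⁺ f a∈ b∈)

∈-grid⁻ : ∀ {A B C : Set} (f : A → B → C) as bs {c} → c ∈ grid f as bs →
          ∃₂ λ a b → a ∈ as × b ∈ bs × c ≡ f a b
∈-grid⁻ f as bs c∈ =
  ∈-cartesianProductWith⁻ f as bs (subst (_ ∈_) (grid≡cartesianProductWith f as bs) c∈)

maxL-upper : ∀ {x} xs → x ∈ xs → x ℤ.≤ maxL xs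
maxL-upper {x} (y ∷ ys) x∈ = foldr-preservesᵒ {P = x ℤ.≤_} {f = _⊔_} ⊔-keeps y ys (located x∈)
  where
  ⊔-keeps : ∀ a b → x ℤ.≤ a ⊎ x ℤ.≤ b → x ℤ.≤ a ⊔ b
  ⊔-keeps a b (inj₁ x≤a) = ℤP.≤-trans x≤a (ℤP.i≤i⊔j a b)
  ⊔-keeps a b (inj₂ x≤b) = ℤP.≤-trans x≤b (ℤP.i≤j⊔i a b)
  located : x ∈ y ∷ ys → x ℤ.≤ y ⊎ Any (x ℤ.≤_) ys
  located (here x≡y)   = inj₁ (ℤP.≤-reflexive x≡y)
  located (there x∈ys) = inj₂ (Any.map ℤP.≤-reflexive x∈ys)

maxL-∈ : ∀ {x} xs → x ∈ xs → maxL xs ∈ xs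
maxL-∈ (y ∷ ys) _ with foldr-selective ℤP.⊔-sel y ys
... | inj₁ max≡y  = here max≡y
... | inj₂ max∈ys = there max∈ys

∈-range⁺ : ∀ {a b s} → a ≤ s → s ≤ b → s ∈ range a b
∈-range⁺ {a} {b} a≤s s≤b =
  subst (_∈ range a b) (m+[n∸m]≡n a≤s) (∈-map⁺ (_+_ a) (∈-upTo⁺ (∸-monoˡ-< (s≤s s≤b) a≤s)))

∈-range⁻ : ∀ {a b s} → s ∈ range a b → a ≤ s × s ≤ b
∈-range⁻ {a} {b} s∈ with ∈-map⁻ (_+_ a) s∈
... | i , i∈ , refl = m≤m+n a i , a+i≤b
  where
  i<1+b∸a : i < suc b ∸ a
  i<1+b∸a = ∈-upTo⁻ i∈
  a≤1+b : a ≤ suc b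
  a≤1+b = <⇒≤ (m∸n≢0⇒n<m (λ 1+b∸a≡0 → n≮0 (subst (i <_) 1+b∸a≡0 i<1+b∸a)))
  a+i≤b : a + i ≤ b
  a+i≤b = subst (_≤ b) (+-comm i a) (s≤s⁻¹ (m≤o∸n⇒m+n≤o (suc i) a≤1+b i<1+b∸a))

-- One level of the recursion, in the notation of the informal statement: level i has
-- sizes a = m_i and b = m'_i, the levels below have sizes A = Σ_{j<i} m_j and
-- B = Σ_{j<i} m'_j, the totals up to level i are X and Y, the choices on level i are
-- s and t, and c is the value of the levels below.  outer is the part of F_i outside the
-- maximum and inner the maximand.
outer : (a b X Y : ℕ) → ℤ
outer a b X Y = + (b * Y) ℤ.+ + (a * (X + Y))

inner : (A a B X Y s t : ℕ) → ℤ → ℤ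
inner A a B X Y s t c =
  c ℤ.+ (+ t) ℤ.* (+ B ℤ.- + a ℤ.- + (2 * Y))
    ℤ.+ (+ s) ℤ.* (+ (A + B) ℤ.- + (2 * (X + Y)))
    ℤ.+ (+ (s + t)) ℤ.* (+ (s + t))

inner-mono : ∀ A a B X Y s t {c c₂} → c ℤ.≤ c₂ → inner A a B X Y s t c ℤ.≤ inner A a B X Y s t c₂
inner-mono A a B X Y s t c≤c₂ = ℤP.+-monoˡ-≤ _ (ℤP.+-monoˡ-≤ _ (ℤP.+-monoˡ-≤ _ c≤c₂))

-- The choices s ∈ [L_i, U_i] allowed on a level of size a above levels of total size A,
-- for the total X: 0 ≤ s ≤ a, s ≤ X and X - s ≤ A.
choices : (A a X : ℕ) → List ℕ
choices A a X = range (X ∸ A) (a ⊓ X)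

choice-bounds : ∀ {A a X s} → s ∈ choices A a X → s ≤ a × s ≤ X × X ∸ s ≤ A
choice-bounds {A} {a} {X} {s} s∈ with ∈-range⁻ s∈
... | X∸A≤s , s≤a⊓X =
  ≤-trans s≤a⊓X (m⊓n≤m a X) , ≤-trans s≤a⊓X (m⊓n≤n a X) ,
  ≤-trans (∸-monoˡ-≤ s (≤-trans (m≤n+m∸n X A) (+-monoʳ-≤ A X∸A≤s))) (≤-reflexive (m+n∸n≡m A s))

least-choice : ∀ {A a X} → X ≤ A + a → X ∸ A ∈ choices A a X
least-choice {A} {a} {X} X≤A+a =
  ∈-range⁺ ≤-refl (⊓-glb (≤-trans (∸-monoˡ-≤ A X≤A+a) (≤-reflexive (m+n∸m≡n A a))) (m∸n≤m X A))

own-choice : ∀ {A a P s} → P ≤ A → s ≤ a → s ∈ choices A a (P + s)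
own-choice {A} {a} {P} {s} P≤A s≤a =
  ∈-range⁺ (≤-trans (∸-monoˡ-≤ A (+-monoˡ-≤ s P≤A)) (≤-reflexive (m+n∸m≡n A s)))
           (⊓-glb s≤a (m≤n+m s P))

module Recursion (m m' : ℕ → ℕ) where

  candidate : ℕ → ℕ → ℕ → ℕ → ℕ → ℤ
  candidate i X Y s t = inner (psum m i) (m i) (psum m' i) X Y s t (Fr m m' i (X ∸ s) (Y ∸ t))

  candidates : ℕ → ℕ → ℕ → List ℤ
  candidates i X Y =
    grid (candidate i X Y) (choices (psum m i) (m i) X) (choices (psum m' i) (m' i) Y)

  value : ℕ → (ℕ → ℕ) → (ℕ → ℕ) → ℤ
  value zero    x y = + 0
  value (suc i) x y =
    outer (m i) (m' i) X Y ℤ.+ inner (psum m i) (m i) (psum m' i) X Y (x i) (y i) (value i x y)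
    where
    X Y : ℕ
    X = psum x (suc i)
    Y = psum y (suc i)

  value-suc : ∀ i x y {X Y s t c} →
    psum x (suc i) ≡ X → psum y (suc i) ≡ Y → x i ≡ s → y i ≡ t → value i x y ≡ c →
    value (suc i) x y ≡ outer (m i) (m' i) X Y ℤ.+ inner (psum m i) (m i) (psum m' i) X Y s t c
  value-suc i x y refl refl refl refl refl = refl

  value-cong : ∀ n {x x₂ y y₂} → AgreeBelow n x x₂ → AgreeBelow n y y₂ → value n x y ≡ value n x₂ y₂
  value-cong zero    _   _   = refl
  value-cong (suc n) {x} {_} {y} x≗ y≗ =
    value-suc n x y (psum-cong (suc n) x≗) (psum-cong (suc n) y≗) (at-top x≗) (at-top y≗)
              (value-cong n (below x≗) (below y≗))

  record Realisation (n X Y : ℕ) (v : ℤ) : Set where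
    field
      x y     : ℕ → ℕ
      x≤m     : Bounded n x m
      y≤m'    : Bounded n y m'
      total-x : psum x n ≡ X
      total-y : psum y n ≡ Y
      value≡  : value n x y ≡ v

  extend-realisation : ∀ {n X Y s t v} → s ≤ m n → t ≤ m' n → s ≤ X → t ≤ Y →
    Realisation n (X ∸ s) (Y ∸ t) v →
    Realisation (suc n) X Y
      (outer (m n) (m' n) X Y ℤ.+ inner (psum m n) (m n) (psum m' n) X Y s t v)
  extend-realisation {n} {X} {Y} {s} {t} s≤ t≤ s≤X t≤Y r = record
    { x       = set x n s
    ; y       = set y n t
    ; x≤m     = set-bounded x≤m s≤
    ; y≤m'    = set-bounded y≤m' t≤
    ; total-x = total-x′
    ; total-y = total-y′
    ; value≡  = value-suc n (set x n s) (set y n t) total-x′ total-y′ (set-at x n s) (set-at y n t)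
                  (trans (value-cong n (set-below x n s) (set-below y n t)) value≡)
    }
    where
    open Realisation r
    total-x′ : psum (set x n s) (suc n) ≡ X
    total-x′ = trans (cong₂ _+_ (trans (psum-cong n (set-below x n s)) total-x) (set-at x n s))
                     (m∸n+n≡m s≤X)
    total-y′ : psum (set y n t) (suc n) ≡ Y
    total-y′ = trans (cong₂ _+_ (trans (psum-cong n (set-below y n t)) total-y) (set-at y n t))
                     (m∸n+n≡m t≤Y)

  value≤Fr : ∀ n {x y} → Bounded n x m → Bounded n y m' →
             value n x y ℤ.≤ Fr m m' n (psum x n) (psum y n)
  value≤Fr zero    _   _   = ℤP.≤-refl
  value≤Fr (suc n) {x} {y} x≤m y≤m' = ℤP.+-monoʳ-≤ (outer (m n) (m' n) X Y) (begin
      at-level (x n) (y n) (value n x y)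
        ≤⟨ inner-mono (psum m n) (m n) (psum m' n) X Y (x n) (y n)
                      (value≤Fr n (below x≤m) (below y≤m')) ⟩
      at-level (x n) (y n) (Fr m m' n (psum x n) (psum y n))
        ≡⟨ cong₂ (λ u v → at-level (x n) (y n) (Fr m m' n u v))
                 (sym (m+n∸n≡m (psum x n) (x n))) (sym (m+n∸n≡m (psum y n) (y n))) ⟩
      at-level (x n) (y n) (Fr m m' n (X ∸ x n) (Y ∸ y n))
        ≤⟨ maxL-upper (candidates n X Y)
             (∈-grid⁺ (candidate n X Y)
                      (own-choice (psum-mono n (below x≤m)) (at-top x≤m))
                      (own-choice (psum-mono n (below y≤m')) (at-top y≤m'))) ⟩
      maxL (candidates n X Y) ∎)
    where
    open ℤP.≤-Reasoning
    X Y : ℕ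
    X = psum x (suc n)
    Y = psum y (suc n)
    at-level : ℕ → ℕ → ℤ → ℤ
    at-level = inner (psum m n) (m n) (psum m' n) X Y

  Fr-realised : ∀ n {X Y} → X ≤ psum m n → Y ≤ psum m' n → Realisation n X Y (Fr m m' n X Y)
  Fr-realised zero X≤0 Y≤0 rewrite n≤0⇒n≡0 X≤0 | n≤0⇒n≡0 Y≤0 = record
    { x = λ _ → 0 ; y = λ _ → 0 ; x≤m = λ _ () ; y≤m' = λ _ ()
    ; total-x = refl ; total-y = refl ; value≡ = refl }
  Fr-realised (suc n) {X} {Y} X≤ Y≤
    with ∈-grid⁻ (candidate n X Y) (choices (psum m n) (m n) X) (choices (psum m' n) (m' n) Y)
           (maxL-∈ (candidates n X Y)
              (∈-grid⁺ (candidate n X Y) (least-choice {psum m n} X≤)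
                                         (least-choice {psum m' n} Y≤)))
  ... | s , t , s∈ , t∈ , max≡
    with s≤m  , s≤X , X∸s≤ ← choice-bounds s∈
       | t≤m' , t≤Y , Y∸t≤ ← choice-bounds t∈
    = subst (Realisation (suc n) X Y) (cong (ℤ._+_ (outer (m n) (m' n) X Y)) (sym max≡))
        (extend-realisation s≤m t≤m' s≤X t≤Y (Fr-realised n X∸s≤ Y∸t≤))

  value≤maxFk : ∀ k {x y} → Bounded (suc k) x m → Bounded (suc k) y m' →
                value (suc k) x y ℤ.≤ maxFk k m m'
  value≤maxFk k x≤m y≤m' =
    ℤP.≤-trans (value≤Fr (suc k) x≤m y≤m')
      (maxL-upper _ (∈-grid⁺ (F m m' k) (∈-range⁺ z≤n (psum-mono (suc k) x≤m))
                                        (∈-range⁺ z≤n (psum-mono (suc k) y≤m'))))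

  maxFk-realised : ∀ k → ∃₂ λ X Y → Realisation (suc k) X Y (maxFk k m m')
  maxFk-realised k
    with ∈-grid⁻ (F m m' k) (range 0 (psum m (suc k))) (range 0 (psum m' (suc k)))
           (maxL-∈ _ (∈-grid⁺ (F m m' k) (∈-range⁺ {b = psum m (suc k)} z≤n z≤n)
                                          (∈-range⁺ {b = psum m' (suc k)} z≤n z≤n)))
  ... | X , Y , X∈ , Y∈ , max≡ =
    X , Y , subst (Realisation (suc k) X Y) (sym max≡)
                  (Fr-realised (suc k) (proj₂ (∈-range⁻ {0} X∈)) (proj₂ (∈-range⁻ {0} Y∈)))

-- The size of a cut in terms of the level counts below n of its vertices on the v-side
-- (x inside, z outside) and on the v'-side (y inside, z' outside).  The four terms count
-- the edges leaving S inside the v-clique, from v_i to a lower v'_j, from v'_j to a higher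
-- v_i, and inside the v'-clique.
cutPoly : ℕ → (x z y z' : ℕ → ℕ) → ℕ
cutPoly n x z y z' =
  (psum x n * psum z n + psum (λ i → x i * psum z' i) n) +
  (psum (λ i → z i * psum y i) n + psum y n * psum z' n)

-- Adding one level to cutPoly matches one level of the recursion, as an identity of
-- integer polynomials: p, s, zp, zn stand for Σ_{j<i} x_j, x_i, Σ_{j<i} z_j, z_i, then q, t,
-- zq, zt for the same counts of y and z', and rx, rz for the two cross sums below level i.
cutPoly-step-ℤ : ∀ (p s zp zn q t zq zt rx rz : ℤ) →
    (p ℤ.+ s) ℤ.* (zp ℤ.+ zn) ℤ.+ (rx ℤ.+ s ℤ.* zq) ℤ.+
    ((rz ℤ.+ zn ℤ.* q) ℤ.+ (q ℤ.+ t) ℤ.* (zq ℤ.+ zt))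
  ≡ (t ℤ.+ zt) ℤ.* (q ℤ.+ t) ℤ.+ (s ℤ.+ zn) ℤ.* ((p ℤ.+ s) ℤ.+ (q ℤ.+ t)) ℤ.+
    ((p ℤ.* zp ℤ.+ rx) ℤ.+ (rz ℤ.+ q ℤ.* zq)
      ℤ.+ t ℤ.* ((q ℤ.+ zq) ℤ.- (s ℤ.+ zn) ℤ.- + 2 ℤ.* (q ℤ.+ t))
      ℤ.+ s ℤ.* (((p ℤ.+ zp) ℤ.+ (q ℤ.+ zq)) ℤ.- + 2 ℤ.* ((p ℤ.+ s) ℤ.+ (q ℤ.+ t)))
      ℤ.+ (s ℤ.+ t) ℤ.* (s ℤ.+ t))
cutPoly-step-ℤ = solve-∀

-- The same identity for natural numbers cast to ℤ: a = s + zn and b = t + zt are the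
-- sizes of level i, A = P + Zp and B = Q + Zq those of the levels below, and c is the cast
-- of cutPoly below level i.
cutPoly-step : ∀ P s Zp zn Q t Zq zt Rx Rz {A a B b c} →
  P + Zp ≡ A → s + zn ≡ a → Q + Zq ≡ B → t + zt ≡ b → + ((P * Zp + Rx) + (Rz + Q * Zq)) ≡ c →
  + ((P + s) * (Zp + zn) + (Rx + s * Zq) + ((Rz + zn * Q) + (Q + t) * (Zq + zt)))
    ≡ outer a b (P + s) (Q + t) ℤ.+ inner A a B (P + s) (Q + t) s t c
cutPoly-step P s Zp zn Q t Zq zt Rx Rz refl refl refl refl refl =
  trans (cong₂ ℤ._+_ (cong₂ ℤ._+_ (pos-* (P + s) (Zp + zn)) (cong (ℤ._+_ (+ Rx)) (pos-* s Zq)))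
                     (cong₂ ℤ._+_ (cong (ℤ._+_ (+ Rz)) (pos-* zn Q)) (pos-* (Q + t) (Zq + zt))))
  (trans (cutPoly-step-ℤ (+ P) (+ s) (+ Zp) (+ zn) (+ Q) (+ t) (+ Zq) (+ zt) (+ Rx) (+ Rz))
  (sym (cong₂ ℤ._+_
    (cong₂ ℤ._+_ (pos-* (t + zt) (Q + t)) (pos-* (s + zn) ((P + s) + (Q + t))))
    (cong (ℤ._+ (+ (s + t)) ℤ.* (+ (s + t)))
      (cong₂ ℤ._+_
        (cong₂ ℤ._+_
          (cong₂ ℤ._+_ (cong (ℤ._+ + Rx) (pos-* P Zp)) (cong (ℤ._+_ (+ Rz)) (pos-* Q Zq)))
          (cong (λ w → + t ℤ.* (+ (Q + Zq) ℤ.- + (s + zn) ℤ.- w)) (pos-* 2 (Q + t))))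
        (cong (λ w → + s ℤ.* (+ ((P + Zp) + (Q + Zq)) ℤ.- w)) (pos-* 2 ((P + s) + (Q + t)))))))))
  where open ℤP using (pos-*)

cutPoly≡value : ∀ (m m' : ℕ → ℕ) n {x z y z'} →
  AgreeBelow n (λ i → x i + z i) m → AgreeBelow n (λ i → y i + z' i) m' →
  + cutPoly n x z y z' ≡ Recursion.value m m' n x y
cutPoly≡value m m' zero    _   _   = refl
cutPoly≡value m m' (suc n) {x} {z} {y} {z'} x+z≗m y+z'≗m' =
  cutPoly-step (psum x n) (x n) (psum z n) (z n) (psum y n) (y n) (psum z' n) (z' n)
    (psum (λ i → x i * psum z' i) n) (psum (λ i → z i * psum y i) n)
    (trans (psum-+ x z n) (psum-cong n (below x+z≗m))) (at-top x+z≗m)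
    (trans (psum-+ y z' n) (psum-cong n (below y+z'≗m'))) (at-top y+z'≗m')
    (cutPoly≡value m m' n (below x+z≗m) (below y+z'≗m'))

∑ : {A : Set} → List A → (A → ℕ) → ℕ
∑ L f = sum (map f L)

∑-cong : ∀ {A : Set} (L : List A) {f g} → (∀ u → f u ≡ g u) → ∑ L f ≡ ∑ L g
∑-cong L f≗g = cong sum (map-cong f≗g L)

∑-++ : ∀ {A : Set} (L₁ L₂ : List A) f → ∑ (L₁ ++ L₂) f ≡ ∑ L₁ f + ∑ L₂ f
∑-++ L₁ L₂ f = trans (cong sum (map-++ f L₁ L₂)) (sum-++ (map f L₁) (map f L₂))

∑-map : ∀ {A B : Set} (h : A → B) L f → ∑ (map h L) f ≡ ∑ L (f ∘ h)
∑-map h L f = cong sum (sym (map-∘ L))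

sum-concatMap : ∀ {A : Set} (h : A → List ℕ) L → sum (concatMap h L) ≡ ∑ L (sum ∘ h)
sum-concatMap h []      = refl
sum-concatMap h (u ∷ L) =
  trans (sum-++ (h u) (concatMap h L)) (cong (_+_ (sum (h u))) (sum-concatMap h L))

∑-concatMap : ∀ {A B : Set} (h : A → List B) L f → ∑ (concatMap h L) f ≡ ∑ L (λ u → ∑ (h u) f)
∑-concatMap h L f = trans (cong sum (map-concatMap f h L)) (sum-concatMap (map f ∘ h) L)

∑-+ : ∀ {A : Set} (L : List A) f g → ∑ L (λ u → f u + g u) ≡ ∑ L f + ∑ L g
∑-+ []      f g = refl
∑-+ (u ∷ L) f g =
  trans (cong (_+_ (f u + g u)) (∑-+ L f g)) (+-interchange (f u) (g u) (∑ L f) (∑ L g))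

∑-*ˡ : ∀ {A : Set} (L : List A) c f → ∑ L (λ u → c * f u) ≡ c * ∑ L f
∑-*ˡ []      c f = sym (*-zeroʳ c)
∑-*ˡ (u ∷ L) c f = trans (cong (_+_ (c * f u)) (∑-*ˡ L c f)) (sym (*-distribˡ-+ c (f u) (∑ L f)))

∑-*ʳ : ∀ {A : Set} (L : List A) c f → ∑ L (λ u → f u * c) ≡ ∑ L f * c
∑-*ʳ L c f = trans (∑-cong L (λ u → *-comm (f u) c)) (trans (∑-*ˡ L c f) (*-comm c (∑ L f)))

∑-product : ∀ {A B : Set} (L₁ : List A) (L₂ : List B) p q →
            ∑ L₁ (λ a → ∑ L₂ (λ b → p a * q b)) ≡ ∑ L₁ p * ∑ L₂ q
∑-product L₁ L₂ p q = trans (∑-cong L₁ (λ a → ∑-*ˡ L₂ (p a) q)) (∑-*ʳ L₁ (∑ L₂ q) p)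

∑-swap : ∀ {A B : Set} (L₁ : List A) (L₂ : List B) (f : A → B → ℕ) →
         ∑ L₁ (λ a → ∑ L₂ (f a)) ≡ ∑ L₂ (λ b → ∑ L₁ (λ a → f a b))
∑-swap []       L₂ f = sym (∑-zero L₂)
  where
  ∑-zero : ∀ {B : Set} (L : List B) → ∑ L (λ _ → 0) ≡ 0
  ∑-zero []      = refl
  ∑-zero (_ ∷ L) = ∑-zero L
∑-swap (a ∷ L₁) L₂ f = trans (cong (_+_ (∑ L₂ (f a))) (∑-swap L₁ L₂ f)) (sym (∑-+ L₂ (f a) _))

∑-⊎ : ∀ {A B : Set} (as : List A) (bs : List B) (f : A ⊎ B → ℕ) →
      ∑ (map inj₁ as ++ map inj₂ bs) f ≡ ∑ as (f ∘ inj₁) + ∑ bs (f ∘ inj₂)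
∑-⊎ as bs f =
  trans (∑-++ (map inj₁ as) (map inj₂ bs) f) (cong₂ _+_ (∑-map inj₁ as f) (∑-map inj₂ bs f))

∑²-⊎ : ∀ {A B : Set} (as : List A) (bs : List B) (g : A ⊎ B → A ⊎ B → ℕ) →
  ∑ (map inj₁ as ++ map inj₂ bs) (λ u → ∑ (map inj₁ as ++ map inj₂ bs) (g u)) ≡
    (∑ as (λ a → ∑ as (g (inj₁ a) ∘ inj₁)) + ∑ as (λ a → ∑ bs (g (inj₁ a) ∘ inj₂))) +
    (∑ bs (λ b → ∑ as (g (inj₂ b) ∘ inj₁)) + ∑ bs (λ b → ∑ bs (g (inj₂ b) ∘ inj₂)))
∑²-⊎ as bs g =
  trans (∑-cong (map inj₁ as ++ map inj₂ bs) (λ u → ∑-⊎ as bs (g u)))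
  (trans (∑-⊎ as bs _) (cong₂ _+_ (∑-+ as _ _) (∑-+ bs _ _)))

extend : ∀ {n} → (Fin n → ℕ) → ℕ → ℕ
extend {zero}  F _       = 0
extend {suc n} F zero    = F fzero
extend {suc n} F (suc i) = extend (F ∘ fsuc) i

extend-< : ∀ {n} (F : Fin n → ℕ) {i} (i<n : i < n) → extend F i ≡ F (fromℕ< i<n)
extend-< {suc n} F {zero}  _   = refl
extend-< {suc n} F {suc i} i<n = extend-< (F ∘ fsuc) (s<s⁻¹ i<n)

extend-toℕ : ∀ {n} (F : Fin n → ℕ) j → extend F (toℕ j) ≡ F j
extend-toℕ F j = trans (extend-< F (toℕ<n j)) (cong F (fromℕ<-toℕ j (toℕ<n j)))

∑-allFin : ∀ n {G : Fin n → ℕ} {H : ℕ → ℕ} → (∀ j → G j ≡ H (toℕ j)) → ∑ (allFin n) G ≡ psum H n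
∑-allFin n {G} G≗H = trans (cong sum (map-tabulate id G)) (sum-tabulate n G≗H)
  where
  sum-tabulate : ∀ n {G : Fin n → ℕ} {H : ℕ → ℕ} → (∀ j → G j ≡ H (toℕ j)) →
                 sum (tabulate G) ≡ psum H n
  sum-tabulate zero    _   = refl
  sum-tabulate (suc n) {H = H} G≗H =
    trans (cong₂ _+_ (G≗H fzero) (sum-tabulate n (G≗H ∘ fsuc))) (sym (psum-shift H n))

∑-allFin-< : ∀ n c → ∑ (allFin n) (λ a → χ (toℕ a <ᵇ c)) ≡ n ⊓ c
∑-allFin-< n c = trans (cong sum (map-tabulate {n = n} id (λ a → χ (toℕ a <ᵇ c)))) (count n c)
  where
  count : ∀ n c → sum (tabulate {n = n} (λ a → χ (toℕ a <ᵇ c))) ≡ n ⊓ c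
  count zero    c       = refl
  count (suc n) zero    = trans (count n zero) (⊓-zeroʳ n)
  count (suc n) (suc c) = cong suc (count n c)

sameVertex-sound : ∀ {n} (f : Fin n → ℕ) u v → sameVertex f u v ≡ true → u ≡ v
sameVertex-sound f (i , a) (j , b) same with toℕ i ℕ.≟ toℕ j
sameVertex-sound f (i , a) (j , b) ()   | no _
... | yes i≡j with toℕ-injective i≡j
...   | refl with toℕ a ℕ.≟ toℕ b
...     | yes a≡b = cong (i ,_) (toℕ-injective a≡b)
sameVertex-sound f (i , a) (i , b) () | yes _ | refl | no _

clique-edge : ∀ {n} (f : Fin n → ℕ) (T : Σ (Fin n) (λ i → Fin (f i)) → Bool) u v →
              χ (T u ∧ not (T v) ∧ not (sameVertex f u v)) ≡ χ (T u) * χ (not (T v))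
clique-edge f T u v with T u in Tu | T v in Tv
... | false | _     = refl
... | true  | true  = refl
... | true  | false with sameVertex f u v in same
...   | false = refl
...   | true  =
  contradiction (trans (sym Tu) (trans (cong T (sameVertex-sound f u v same)) Tv)) λ ()

module Sides (k : ℕ) where

  Side : (ℕ → ℕ) → Set
  Side f = Σ (Fin (suc k)) (λ i → Fin (f (toℕ i)))

  block : (f : ℕ → ℕ) (i : Fin (suc k)) → List (Side f)
  block f i = map (i ,_) (allFin (f (toℕ i)))

  side : (f : ℕ → ℕ) → List (Side f)
  side f = concatMap (block f) (allFin (suc k))

  levelTotal : (f : ℕ → ℕ) → (Side f → ℕ) → Fin (suc k) → ℕ
  levelTotal f w i = ∑ (allFin (f (toℕ i))) (λ a → w (i , a))

  levelSum : (f : ℕ → ℕ) → (Side f → ℕ) → ℕ → ℕ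
  levelSum f w = extend (levelTotal f w)

  inside outside : (f : ℕ → ℕ) → (Side f → Bool) → ℕ → ℕ
  inside  f T = levelSum f (χ ∘ T)
  outside f T = inside f (not ∘ T)

  ∑-side : ∀ f (w : Side f → ℕ) (h : ℕ → ℕ) →
           ∑ (side f) (λ u → w u * h (toℕ (proj₁ u))) ≡ psum (λ i → levelSum f w i * h i) (suc k)
  ∑-side f w h = begin
      ∑ (side f) weighted
    ≡⟨ ∑-concatMap (block f) (allFin (suc k)) weighted ⟩
      ∑ (allFin (suc k)) (λ i → ∑ (block f i) weighted)
    ≡⟨ ∑-cong (allFin (suc k)) (λ i →
         trans (∑-map (i ,_) (allFin (f (toℕ i))) weighted)
               (∑-*ʳ (allFin (f (toℕ i))) (h (toℕ i)) (λ a → w (i , a)))) ⟩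
      ∑ (allFin (suc k)) (λ i → levelTotal f w i * h (toℕ i))
    ≡⟨ ∑-allFin (suc k) (λ i → cong (_* h (toℕ i)) (sym (extend-toℕ (levelTotal f w) i))) ⟩
      psum (λ i → levelSum f w i * h i) (suc k) ∎
    where
    open ≡-Reasoning
    weighted : Side f → ℕ
    weighted u = w u * h (toℕ (proj₁ u))

  ∑-side-total : ∀ f (w : Side f → ℕ) → ∑ (side f) w ≡ psum (levelSum f w) (suc k)
  ∑-side-total f w =
    trans (∑-cong (side f) (λ u → sym (*-identityʳ (w u))))
          (trans (∑-side f w (λ _ → 1)) (psum-cong (suc k) (λ i _ → *-identityʳ (levelSum f w i))))

  ∑-side-below : ∀ f (w : Side f → ℕ) {i} → i ≤ suc k →
                 ∑ (side f) (λ u → w u * χ ⌊ toℕ (proj₁ u) <? i ⌋) ≡ psum (levelSum f w) i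
  ∑-side-below f w {i} i≤ = trans (∑-side f w (λ j → χ ⌊ j <? i ⌋)) (psum-below (levelSum f w) i≤)

  ∑-clique : ∀ f (T : Side f → Bool) →
    ∑ (side f) (λ a → ∑ (side f) (λ b → χ (T a ∧ not (T b) ∧ not (sameVertex (f ∘ toℕ) a b))))
      ≡ psum (inside f T) (suc k) * psum (outside f T) (suc k)
  ∑-clique f T = begin
      ∑ (side f) (λ a → ∑ (side f) (λ b → χ (T a ∧ not (T b) ∧ not (sameVertex (f ∘ toℕ) a b))))
    ≡⟨ ∑-cong (side f) (λ a → ∑-cong (side f) (λ b → clique-edge (f ∘ toℕ) T a b)) ⟩
      ∑ (side f) (λ a → ∑ (side f) (λ b → χ (T a) * χ (not (T b))))
    ≡⟨ ∑-product (side f) (side f) (χ ∘ T) (χ ∘ not ∘ T) ⟩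
      ∑ (side f) (χ ∘ T) * ∑ (side f) (χ ∘ not ∘ T)
    ≡⟨ cong₂ _*_ (∑-side-total f (χ ∘ T)) (∑-side-total f (χ ∘ not ∘ T)) ⟩
      psum (inside f T) (suc k) * psum (outside f T) (suc k) ∎
    where open ≡-Reasoning

  ∑-cross : ∀ f g (T : Side f → Bool) (U : Side g → Bool) →
    ∑ (side f) (λ a → ∑ (side g) (λ b → χ (T a ∧ U b ∧ ⌊ toℕ (proj₁ b) <? toℕ (proj₁ a) ⌋)))
      ≡ psum (λ i → inside f T i * psum (inside g U) i) (suc k)
  ∑-cross f g T U = begin
      ∑ (side f) (λ a → ∑ (side g) (λ b → χ (T a ∧ U b ∧ ⌊ toℕ (proj₁ b) <? toℕ (proj₁ a) ⌋)))
    ≡⟨ ∑-cong (side f) (λ a →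
         trans (∑-cong (side g) (λ b → trans (χ-∧ (T a) _) (cong (_*_ (χ (T a))) (χ-∧ (U b) _))))
               (∑-*ˡ (side g) (χ (T a)) (λ b → χ (U b) * χ ⌊ toℕ (proj₁ b) <? toℕ (proj₁ a) ⌋))) ⟩
      ∑ (side f) (λ a → χ (T a) * ∑ (side g) (λ b → χ (U b) * χ ⌊ toℕ (proj₁ b) <? toℕ (proj₁ a) ⌋))
    ≡⟨ ∑-cong (side f) (λ a →
         cong (_*_ (χ (T a))) (∑-side-below g (χ ∘ U) (<⇒≤ (toℕ<n (proj₁ a))))) ⟩
      ∑ (side f) (λ a → χ (T a) * psum (inside g U) (toℕ (proj₁ a)))
    ≡⟨ ∑-side f (χ ∘ T) (psum (inside g U)) ⟩
      psum (λ i → inside f T i * psum (inside g U) i) (suc k) ∎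
    where open ≡-Reasoning

  inside+outside : ∀ f (T : Side f → Bool) →
                   AgreeBelow (suc k) (λ i → inside f T i + outside f T i) f
  inside+outside f T i i< = begin
      inside f T i + outside f T i
    ≡⟨ cong₂ _+_ (extend-< (levelTotal f (χ ∘ T)) i<) (extend-< (levelTotal f (χ ∘ not ∘ T)) i<) ⟩
      levelTotal f (χ ∘ T) j + levelTotal f (χ ∘ not ∘ T) j
    ≡⟨ sym (∑-+ (allFin (f (toℕ j))) _ _) ⟩
      ∑ (allFin (f (toℕ j))) (λ a → χ (T (j , a)) + χ (not (T (j , a))))
    ≡⟨ ∑-cong (allFin (f (toℕ j))) (λ a → χ-not (T (j , a))) ⟩
      ∑ (allFin (f (toℕ j))) (λ _ → 1)
    ≡⟨ trans (∑-allFin (f (toℕ j)) (λ _ → refl)) (psum-ones (f (toℕ j))) ⟩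
      f (toℕ j)
    ≡⟨ cong f (toℕ-fromℕ< i<) ⟩
      f i ∎
    where
    open ≡-Reasoning
    j : Fin (suc k)
    j = fromℕ< i<

  inside-bounded : ∀ f (T : Side f → Bool) → Bounded (suc k) (inside f T) f
  inside-bounded f T i i< = subst (inside f T i ≤_) (inside+outside f T i i<) (m≤m+n _ _)

  first : (f c : ℕ → ℕ) → Side f → Bool
  first f c (i , a) = toℕ a <ᵇ c (toℕ i)

  inside-first : ∀ f c → Bounded (suc k) c f → AgreeBelow (suc k) (inside f (first f c)) c
  inside-first f c c≤f i i< = begin
      inside f (first f c) i
    ≡⟨ extend-< (levelTotal f (χ ∘ first f c)) i< ⟩
      ∑ (allFin (f (toℕ j))) (λ a → χ (toℕ a <ᵇ c (toℕ j)))
    ≡⟨ ∑-allFin-< (f (toℕ j)) (c (toℕ j)) ⟩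
      f (toℕ j) ⊓ c (toℕ j)
    ≡⟨ cong (λ l → f l ⊓ c l) (toℕ-fromℕ< i<) ⟩
      f i ⊓ c i
    ≡⟨ m≥n⇒m⊓n≡n (c≤f i i<) ⟩
      c i ∎
    where
    open ≡-Reasoning
    j : Fin (suc k)
    j = fromℕ< i<

module Cuts (k : ℕ) (m m' : ℕ → ℕ) where
  open Sides k
  open Recursion m m'

  profile profile′ : (GTV k m m' → Bool) → ℕ → ℕ
  profile  S = inside m  (S ∘ inj₁)
  profile′ S = inside m' (S ∘ inj₂)

  cutSize≡cutPoly : ∀ S → cutSize (GT k m m') S ≡
    cutPoly (suc k) (profile S) (outside m (S ∘ inj₁)) (profile′ S) (outside m' (S ∘ inj₂))
  cutSize≡cutPoly S =
    trans (sum-concatMap (λ u → map (edge u) vertices) vertices)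
    (trans (∑²-⊎ (side m) (side m') edge)
           (cong₂ _+_ (cong₂ _+_ (∑-clique m (S ∘ inj₁)) (∑-cross m m' (S ∘ inj₁) (not ∘ S ∘ inj₂)))
                      (cong₂ _+_ upward (∑-clique m' (S ∘ inj₂)))))
    where
    vertices : List (GTV k m m')
    vertices = verts (GT k m m')
    edge : GTV k m m' → GTV k m m' → ℕ
    edge u v = χ (S u ∧ not (S v) ∧ adj (GT k m m') u v)
    upward : ∑ (side m') (λ b → ∑ (side m) (edge (inj₂ b) ∘ inj₁)) ≡
             psum (λ i → outside m (S ∘ inj₁) i * psum (profile′ S) i) (suc k)
    upward =
      trans (∑-swap (side m') (side m) (λ b → edge (inj₂ b) ∘ inj₁))
      (trans (∑-cong (side m) (λ a → ∑-cong (side m') (λ b →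
                cong χ (∧-left-comm (S (inj₂ b)) (not (S (inj₁ a))) _))))
             (∑-cross m m' (not ∘ S ∘ inj₁) (S ∘ inj₂)))

  cutSize≡value : ∀ S → + cutSize (GT k m m') S ≡ value (suc k) (profile S) (profile′ S)
  cutSize≡value S =
    trans (cong +_ (cutSize≡cutPoly S))
          (cutPoly≡value m m' (suc k) (inside+outside m (S ∘ inj₁)) (inside+outside m' (S ∘ inj₂)))

  firsts : (x y : ℕ → ℕ) → GTV k m m' → Bool
  firsts x y (inj₁ u) = first m  x u
  firsts x y (inj₂ v) = first m' y v

  realised-cut : ∀ {X Y v} → Realisation (suc k) X Y v → ∃ λ S → + cutSize (GT k m m') S ≡ v
  realised-cut {v = v} r = firsts x y , (begin
      + cutSize (GT k m m') (firsts x y)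
    ≡⟨ cutSize≡value (firsts x y) ⟩
      value (suc k) (profile (firsts x y)) (profile′ (firsts x y))
    ≡⟨ value-cong (suc k) {profile (firsts x y)} {x} {profile′ (firsts x y)} {y}
                  (inside-first m x x≤m) (inside-first m' y y≤m') ⟩
      value (suc k) x y
    ≡⟨ value≡ ⟩
      v ∎)
    where
    open Realisation r
    open ≡-Reasoning

theorem3 : (k : ℕ) (m m' : ℕ → ℕ) →
    (∀ i → i ≤ k → 1 ≤ m i) →
    (∀ i → i < k → 1 ≤ m' i) →
    IsMaxCutSize (GT k m m') (maxFk k m m')
theorem3 k m m' _ _ = optimal-cut , every-cut-≤
  where
  open Sides k
  open Recursion m m'
  open Cuts k m m'

  optimal-cut : ∃ λ S → + cutSize (GT k m m') S ≡ maxFk k m m'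
  optimal-cut = realised-cut (proj₂ (proj₂ (maxFk-realised k)))

  every-cut-≤ : ∀ S → + cutSize (GT k m m') S ℤ.≤ maxFk k m m'
  every-cut-≤ S =
    subst (ℤ._≤ maxFk k m m') (sym (cutSize≡value S))
          (value≤maxFk k (inside-bounded m (S ∘ inj₁)) (inside-bounded m' (S ∘ inj₂)))
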